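{- Let $r\geq 3$ and let $\epsilon,d>0$ with $\epsilon\leq(d/2)^{r-2}$. Let $G$ be a balanced $r$-partite graph on $V_1\sqcup\cdots\sqcup V_r$ with $|V_i|=n$ for all $i$, such that $(V_1,V_i)$ is $(\epsilon,d)$-super-regular with respect to $G$ for all $i\in\{2,\ldots,r\}$. Let $F=F_{V_1}[V_2,\ldots,V_r]$. Then: (i) every vertex of $F$ lies in at least $(1-(r-2)\epsilon)n^{r-2}$ edges of $F$; (ii) if $X\subseteq V_1$ and $|X|\geq(2/d)^{r-2}\epsilon n$, then for each $i\in\{2,\ldots,r\}$, all but at most $\epsilon n$ vertices of $V_i$ lie in at least $(1-2(r-2)\epsilon)n^{r-2}$ edges of $F_X=F_X[V_2,\ldots,V_r]$.
   Context: A pair $(A,B)$ is $(\epsilon,d)$-super-regular if (1) for all $X\subseteq A$, $Y\subseteq B$ with $|X|\ge\epsilon|A|$, $|Y|\ge\epsilon|B|$, the density $e(X,Y)/(|X||Y|)>d$, and (2) every vertex of $A$ has more than $d|B|$ neighbours in $B$ and every vertex of $B$ has more than $d|A|$ neighbours in $A$. $F=F_{V_1}[V_2,\ldots,V_r]$ is the $(r-1)$-uniform $(r-1)$-partite hypergraph with vertex classes $V_2,\ldots,V_r$ whose edges are the tuples $(v_2,\ldots,v_r)\in V_2\times\cdots\times V_r$ such that $v_2,\ldots,v_r$ have at least $(d/2)^{r-1}|V_1|$ common neighbours (in $G$) in $V_1$. For $X\subseteq V_1$, $F_X=F_X[V_2,\ldots,V_r]$ is the subhypergraph of $F$ consisting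 of those edges $(v_2,\ldots,v_r)$ of $F$ whose vertices have in addition at least $(d/2)^{r-1}|X|$ common neighbours in $X$. The degree of a vertex in a hypergraph is the number of edges containing it.
   Formalization: The parameters ε and d take rational values, both in the hypotheses and in the definitions of super-regularity and of the hypergraphs F and F_X. -}

module Defs where

open import Data.Nat using (ℕ; zero; suc)
import Data.Nat as ℕ
open import Data.Bool using (Bool; true; false; _∧_; if_then_else_)
open import Data.Fin using (Fin; zero; suc; _≟_)
open import Data.Vec.Functional using (_∷_)
open import Data.Integer using (+_)
open import Data.Rational using (ℚ; _/_; _*_; _<_; _≤_; 1ℚ; ½; _≤?_)
open import Data.Product using (_×_)
open import Relation.Binary.PropositionalEquality using (_≡_)
open import Relation.Nullary.Decidable using (⌊_⌋)

⟦_⟧ : ℕ → ℚ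
⟦ n ⟧ = + n / 1

_^ℚ_ : ℚ → ℕ → ℚ
q ^ℚ zero = 1ℚ
q ^ℚ suc m = q * (q ^ℚ m)

sumF : ∀ {n} → (Fin n → ℕ) → ℕ
sumF {zero} f = 0
sumF {suc n} f = f zero ℕ.+ sumF (λ i → f (suc i))

𝟙 : Bool → ℕ
𝟙 true = 1
𝟙 false = 0

-- number of elements of Fin n satisfying a boolean predicate
-- (a subset of Fin n is represented by its characteristic function; this is its size)
∣_∣ : ∀ {n} → (Fin n → Bool) → ℕ
∣ P ∣ = sumF (λ i → 𝟙 (P i))

allF : ∀ {k} → (Fin k → Bool) → Bool
allF {zero} f = true
allF {suc k} f = f zero ∧ allF (λ i → f (suc i))

countTuples : ∀ {k n} → ((Fin k → Fin n) → Bool) → ℕ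
countTuples {zero} P = 𝟙 (P (λ ()))
countTuples {suc k} P = sumF (λ a → countTuples (λ t → P (a ∷ t)))

-- A graph on the vertex set (Fin r) × (Fin n): class i is {i} × Fin n, each of size n.
-- Adjacency is a Boolean function E i a j b  ("vertex a of class i ~ vertex b of class j").
Graph : ℕ → ℕ → Set
Graph r n = Fin r → Fin n → Fin r → Fin n → Bool

IsRPartiteGraph : ∀ {r n} → Graph r n → Set
IsRPartiteGraph {r} {n} E =
  ((i j : Fin r) (a b : Fin n) → E i a j b ≡ E j b i a) ×
  ((i : Fin r) (a b : Fin n) → E i a i b ≡ false)

eXY : ∀ {r n} → Graph r n → (i j : Fin r) → (Fin n → Bool) → (Fin n → Bool) → ℕ
eXY E i j X Y = sumF (λ a → sumF (λ b → 𝟙 (X a ∧ Y b ∧ E i a j b)))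

-- (ε,d)-super-regularity of the pair (V_i, V_j); |V_i| = |V_j| = n.
-- density e(X,Y)/(|X||Y|) > d is written e(X,Y) > d |X| |Y|
SuperRegular : ∀ {r n} → ℚ → ℚ → Graph r n → Fin r → Fin r → Set
SuperRegular {r} {n} ε d E i j =
  ((X Y : Fin n → Bool) → ε * ⟦ n ⟧ ≤ ⟦ ∣ X ∣ ⟧ → ε * ⟦ n ⟧ ≤ ⟦ ∣ Y ∣ ⟧ →
     d * ⟦ ∣ X ∣ ⟧ * ⟦ ∣ Y ∣ ⟧ < ⟦ eXY E i j X Y ⟧) ×
  ((a : Fin n) → d * ⟦ n ⟧ < ⟦ ∣ (λ b → E i a j b) ∣ ⟧) ×
  ((b : Fin n) → d * ⟦ n ⟧ < ⟦ ∣ (λ a → E i a j b) ∣ ⟧)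

-- The graph has r = suc k classes: V₁ is class zero, V_{j+2} is class suc j (j : Fin k).
-- A tuple (v₂,…,v_r) ∈ V₂ × ⋯ × V_r is a function t : Fin k → Fin n.

V₁ : ∀ {n} → Fin n → Bool
V₁ _ = true

commonNbrs : ∀ {k n} → Graph (suc k) n → (Fin n → Bool) → (Fin k → Fin n) → ℕ
commonNbrs E X t = ∣ (λ a → X a ∧ allF (λ j → E zero a (suc j) (t j))) ∣

-- edge of F_X[V₂,…,V_r]: at least (d/2)^{r-1}|V₁| common neighbours in V₁
-- and at least (d/2)^{r-1}|X| common neighbours in X   (r - 1 = k).
-- For X = V₁ this is exactly F = F_{V₁}[V₂,…,V_r].
isEdgeF : ∀ {k n} → ℚ → Graph (suc k) n → (Fin n → Bool) → (Fin k → Fin n) → Bool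
isEdgeF {k} {n} d E X t =
  ⌊ ((d * ½) ^ℚ k) * ⟦ n ⟧ ≤? ⟦ commonNbrs E V₁ t ⟧ ⌋ ∧
  ⌊ ((d * ½) ^ℚ k) * ⟦ ∣ X ∣ ⟧ ≤? ⟦ commonNbrs E X t ⟧ ⌋

degF : ∀ {k n} → ℚ → Graph (suc k) n → (Fin n → Bool) → Fin k → Fin n → ℕ
degF d E X j v = countTuples (λ t → ⌊ t j ≟ v ⌋ ∧ isEdgeF d E X t)

module Submission where

-- Fix a vertex v of a class V_j.  The remaining r - 2 vertices of an edge through v are chosen
-- greedily, class by class, keeping track of the set Y ⊆ V₁ of common neighbours of v and the
-- vertices chosen so far, together with X ∩ Y.  A candidate is good if it has more than d|Y|
-- neighbours in Y and more than d|X ∩ Y| in X ∩ Y; then both sets shrink at most by the factor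
-- d/2, so after the last choice the tuple has (d/2)^(r-1)-fractions of V₁ and of X as common
-- neighbours, i.e. it is an edge of F_X.  Along the way |Y| ≥ (d/2)^(r-2) n ≥ εn and
-- |X ∩ Y| ≥ (d/2)^(r-2) |X| ≥ εn, so by (ε,d)-regularity fewer than εn candidates are bad for
-- each of the two sets.  Hence v lies in at least ((1 - β) n)^(r-2) ≥ (1 - (r-2)β) n^(r-2) edges
-- (Bernoulli), where β = ε for F (there X ∩ Y = Y) and β = 2ε for F_X.  For F_X the vertex v
-- itself must have more than d|X| neighbours in X, and by regularity fewer than εn vertices of
-- V_j fail this.

open import Defs
open import Algebra.Bundles using (CommutativeMonoid)
open import Data.Bool using (Bool; true; false; _∧_; not)
open import Data.Bool.Properties using (∧-commutativeMonoid; ∧-assoc; ∧-identityʳ; ∧-zeroʳ)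
open import Data.Empty using (⊥-elim)
open import Data.Fin using (Fin; zero; suc; _≟_; punchIn)
open import Data.Integer using (+_)
import Data.Integer as ℤ
import Data.Integer.Properties as ℤₚ
open import Data.Nat using (ℕ; zero; suc; _∸_; _^_; z≤n; s≤s)
import Data.Nat as ℕ
import Data.Nat.Coprimality as Coprimality
import Data.Nat.Properties as ℕₚ
open import Data.Product using (_×_; _,_; proj₁; proj₂; Σ-syntax)
open import Data.Rational
  using (ℚ; _+_; _*_; _-_; -_; _≤_; _<_; _≤?_; *≤*; 0ℚ; 1ℚ; ½; toℚᵘ; nonNegative)
open import Data.Rational.Properties hiding (_≟_)
open import Data.Rational.Solver using (module +-*-Solver)
import Data.Rational.Unnormalised as ℚᵘ
import Data.Rational.Unnormalised.Properties as ℚᵘₚ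
open import Data.Vec.Functional using (_∷_; insertAt)
open import Data.Vec.Functional.Properties using (insertAt-lookup; insertAt-punchIn)
open import Function using (_∘_)
open import Function.Definitions using (Congruent)
open import Relation.Binary.PropositionalEquality
open import Relation.Nullary using (Dec; yes; no; ¬_)
open import Relation.Nullary.Decidable using (⌊_⌋; dec-true; isYes≗does)

open import Algebra.Properties.CommutativeSemigroup ℕₚ.+-commutativeSemigroup
  using () renaming (interchange to +-interchange)
open import Algebra.Properties.CommutativeSemigroup
  (CommutativeMonoid.commutativeSemigroup ∧-commutativeMonoid)
  using () renaming (x∙yz≈y∙xz to ∧-swap)
open +-*-Solver using (solve; _:+_; _:*_; _:-_; con; _:=_)

⌊⌋≡true : ∀ {a} {A : Set a} (a? : Dec A) → A → ⌊ a? ⌋ ≡ true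
⌊⌋≡true a? a = trans (isYes≗does a?) (dec-true a? a)

⌊⌋≡true⇒ : ∀ {a} {A : Set a} (a? : Dec A) → ⌊ a? ⌋ ≡ true → A
⌊⌋≡true⇒ (yes a) _ = a

⌊⌋≡false⇒¬ : ∀ {a} {A : Set a} (a? : Dec A) → ⌊ a? ⌋ ≡ false → ¬ A
⌊⌋≡false⇒¬ (no ¬a) _ = ¬a

not∧not≡true⇒ : ∀ {a b} → not a ∧ not b ≡ true → a ≡ false × b ≡ false
not∧not≡true⇒ {false} {false} _ = refl , refl

-- Finite sums and tuples

sumF-cong : ∀ {n} {f g : Fin n → ℕ} → f ≗ g → sumF f ≡ sumF g
sumF-cong {zero}  _   = refl
sumF-cong {suc n} f≗g = cong₂ ℕ._+_ (f≗g zero) (sumF-cong (f≗g ∘ suc))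

sumF-mono : ∀ {n} {f g : Fin n → ℕ} → (∀ i → f i ℕ.≤ g i) → sumF f ℕ.≤ sumF g
sumF-mono {zero}  _   = z≤n
sumF-mono {suc n} f≤g = ℕₚ.+-mono-≤ (f≤g zero) (sumF-mono (f≤g ∘ suc))

sumF-0 : ∀ {n} → sumF {n} (λ _ → 0) ≡ 0
sumF-0 {zero}  = refl
sumF-0 {suc n} = sumF-0 {n}

sumF-+ : ∀ {n} (f g : Fin n → ℕ) → sumF (λ i → f i ℕ.+ g i) ≡ sumF f ℕ.+ sumF g
sumF-+ {zero}  f g = refl
sumF-+ {suc n} f g = begin
  f zero ℕ.+ g zero ℕ.+ sumF (λ i → f (suc i) ℕ.+ g (suc i))
    ≡⟨ cong (f zero ℕ.+ g zero ℕ.+_) (sumF-+ (f ∘ suc) (g ∘ suc)) ⟩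
  f zero ℕ.+ g zero ℕ.+ (sumF (f ∘ suc) ℕ.+ sumF (g ∘ suc))
    ≡⟨ +-interchange (f zero) (g zero) (sumF (f ∘ suc)) (sumF (g ∘ suc)) ⟩
  f zero ℕ.+ sumF (f ∘ suc) ℕ.+ (g zero ℕ.+ sumF (g ∘ suc))
    ∎
  where open ≡-Reasoning

sumF-swap : ∀ {m n} (h : Fin m → Fin n → ℕ) →
  sumF (λ a → sumF (h a)) ≡ sumF (λ b → sumF (λ a → h a b))
sumF-swap {zero}  {n} h = sym (sumF-0 {n})
sumF-swap {suc m}     h = begin
  sumF (h zero) ℕ.+ sumF (λ a → sumF (h (suc a)))
    ≡⟨ cong (sumF (h zero) ℕ.+_) (sumF-swap (h ∘ suc)) ⟩
  sumF (h zero) ℕ.+ sumF (λ b → sumF (λ a → h (suc a) b))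
    ≡⟨ sumF-+ (h zero) (λ b → sumF (λ a → h (suc a) b)) ⟨
  sumF (λ b → h zero b ℕ.+ sumF (λ a → h (suc a) b))
    ∎
  where open ≡-Reasoning

term≤sumF : ∀ {n} (f : Fin n → ℕ) (i : Fin n) → f i ℕ.≤ sumF f
term≤sumF f zero    = ℕₚ.m≤m+n _ _
term≤sumF f (suc i) = ℕₚ.≤-trans (term≤sumF (f ∘ suc) i) (ℕₚ.m≤n+m _ _)

card-cong : ∀ {n} {P Q : Fin n → Bool} → P ≗ Q → ∣ P ∣ ≡ ∣ Q ∣
card-cong P≗Q = sumF-cong (cong 𝟙 ∘ P≗Q)

card-empty : ∀ {n} {P : Fin n → Bool} → (∀ i → P i ≡ false) → ∣ P ∣ ≡ 0
card-empty {n} P≡false = trans (card-cong P≡false) (sumF-0 {n})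

card-V₁ : ∀ {n} → ∣ V₁ {n} ∣ ≡ n
card-V₁ {zero}  = refl
card-V₁ {suc n} = cong suc (card-V₁ {n})

card≤n : ∀ {n} (P : Fin n → Bool) → ∣ P ∣ ℕ.≤ n
card≤n {n} P = ℕₚ.≤-trans (sumF-mono (𝟙≤1 ∘ P)) (ℕₚ.≤-reflexive (card-V₁ {n}))
  where
  𝟙≤1 : ∀ b → 𝟙 b ℕ.≤ 1
  𝟙≤1 true  = s≤s z≤n
  𝟙≤1 false = z≤n

n≤sumF : ∀ {n} (f : Fin n → ℕ) → (∀ i → 1 ℕ.≤ f i) → n ℕ.≤ sumF f
n≤sumF {n} f 1≤f = ℕₚ.≤-trans (ℕₚ.≤-reflexive (sym (card-V₁ {n}))) (sumF-mono 1≤f)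

countTuples-mono : ∀ {m n} {P Q : (Fin m → Fin n) → Bool} →
  (∀ t → P t ≡ true → Q t ≡ true) → countTuples P ℕ.≤ countTuples Q
countTuples-mono {zero}  P⇒Q = 𝟙-mono (P⇒Q _)
  where
  𝟙-mono : ∀ {a b} → (a ≡ true → b ≡ true) → 𝟙 a ℕ.≤ 𝟙 b
  𝟙-mono {false} _   = z≤n
  𝟙-mono {true}  a⇒b rewrite a⇒b refl = ℕₚ.≤-refl
countTuples-mono {suc m} P⇒Q = sumF-mono (λ a → countTuples-mono (λ t → P⇒Q (a ∷ t)))

countTuples-insertAt : ∀ {m n} (P : (Fin (suc m) → Fin n) → Bool) → Congruent _≗_ _≡_ P →
  (i : Fin (suc m)) (v : Fin n) →
  countTuples (λ t → P (insertAt t i v)) ℕ.≤ countTuples (λ t → ⌊ t i ≟ v ⌋ ∧ P t)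
countTuples-insertAt P P-cong zero v = ℕₚ.≤-trans (countTuples-mono insert-v)
  (term≤sumF (λ a → countTuples (λ t → ⌊ a ≟ v ⌋ ∧ P (a ∷ t))) v)
  where
  insert-v : ∀ t → P (insertAt t zero v) ≡ true → ⌊ v ≟ v ⌋ ∧ P (v ∷ t) ≡ true
  insert-v t Pt = cong₂ _∧_ (⌊⌋≡true (v ≟ v) refl)
    (trans (P-cong λ { zero → refl ; (suc _) → refl }) Pt)
countTuples-insertAt {suc m} P P-cong (suc i) v = sumF-mono λ a →
  ℕₚ.≤-trans (countTuples-mono (λ t → trans (shift a t)))
    (countTuples-insertAt (λ t → P (a ∷ t)) (λ t≗u → P-cong λ { zero → refl ; (suc j) → t≗u j }) i v)
  where
  shift : ∀ a t → P (a ∷ insertAt t i v) ≡ P (insertAt (a ∷ t) (suc i) v)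
  shift a t = P-cong λ { zero → refl ; (suc _) → refl }

allF-cong : ∀ {k} {f g : Fin k → Bool} → f ≗ g → allF f ≡ allF g
allF-cong {zero}  _   = refl
allF-cong {suc k} f≗g = cong₂ _∧_ (f≗g zero) (allF-cong (f≗g ∘ suc))

allF-punchIn : ∀ {k} (f : Fin (suc k) → Bool) (i : Fin (suc k)) →
  allF f ≡ f i ∧ allF (f ∘ punchIn i)
allF-punchIn         f zero    = refl
allF-punchIn {suc k} f (suc i) = begin
  f zero ∧ allF (f ∘ suc)                           ≡⟨ cong (f zero ∧_) (allF-punchIn (f ∘ suc) i) ⟩
  f zero ∧ (f (suc i) ∧ allF (f ∘ suc ∘ punchIn i))  ≡⟨ ∧-swap (f zero) (f (suc i)) _ ⟩
  f (suc i) ∧ (f zero ∧ allF (f ∘ suc ∘ punchIn i))  ∎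
  where open ≡-Reasoning

-- Rational arithmetic

toℚᵘ-⟦⟧ : ∀ m → toℚᵘ ⟦ m ⟧ ≡ ℚᵘ.mkℚᵘ (+ m) 0
toℚᵘ-⟦⟧ m = cong toℚᵘ (normalize-coprime (Coprimality.sym (Coprimality.1-coprimeTo m)))

⟦⟧-+ : ∀ m n → ⟦ m ℕ.+ n ⟧ ≡ ⟦ m ⟧ + ⟦ n ⟧
⟦⟧-+ m n = toℚᵘ-injective (begin
  toℚᵘ ⟦ m ℕ.+ n ⟧                          ≡⟨ toℚᵘ-⟦⟧ (m ℕ.+ n) ⟩
  ℚᵘ.mkℚᵘ (+ (m ℕ.+ n)) 0                   ≈⟨ ℚᵘ.*≡* (cong (ℤ._* + 1) numerators) ⟩
  ℚᵘ.mkℚᵘ (+ m) 0 ℚᵘ.+ ℚᵘ.mkℚᵘ (+ n) 0     ≡⟨ cong₂ ℚᵘ._+_ (toℚᵘ-⟦⟧ m) (toℚᵘ-⟦⟧ n) ⟨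
  toℚᵘ ⟦ m ⟧ ℚᵘ.+ toℚᵘ ⟦ n ⟧                 ≈⟨ toℚᵘ-homo-+ ⟦ m ⟧ ⟦ n ⟧ ⟨
  toℚᵘ (⟦ m ⟧ + ⟦ n ⟧)                      ∎)
  where
  open ℚᵘₚ.≃-Reasoning
  numerators : + (m ℕ.+ n) ≡ + m ℤ.* + 1 ℤ.+ + n ℤ.* + 1
  numerators = trans (ℤₚ.pos-+ m n)
    (sym (cong₂ ℤ._+_ (ℤₚ.*-identityʳ (+ m)) (ℤₚ.*-identityʳ (+ n))))

⟦⟧-* : ∀ m n → ⟦ m ℕ.* n ⟧ ≡ ⟦ m ⟧ * ⟦ n ⟧
⟦⟧-* m n = toℚᵘ-injective (begin
  toℚᵘ ⟦ m ℕ.* n ⟧                          ≡⟨ toℚᵘ-⟦⟧ (m ℕ.* n) ⟩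
  ℚᵘ.mkℚᵘ (+ (m ℕ.* n)) 0                   ≈⟨ ℚᵘ.*≡* (cong (ℤ._* + 1) (ℤₚ.pos-* m n)) ⟩
  ℚᵘ.mkℚᵘ (+ m) 0 ℚᵘ.* ℚᵘ.mkℚᵘ (+ n) 0     ≡⟨ cong₂ ℚᵘ._*_ (toℚᵘ-⟦⟧ m) (toℚᵘ-⟦⟧ n) ⟨
  toℚᵘ ⟦ m ⟧ ℚᵘ.* toℚᵘ ⟦ n ⟧                 ≈⟨ toℚᵘ-homo-* ⟦ m ⟧ ⟦ n ⟧ ⟨
  toℚᵘ (⟦ m ⟧ * ⟦ n ⟧)                      ∎)
  where open ℚᵘₚ.≃-Reasoning

⟦⟧-^ : ∀ n m → ⟦ n ^ m ⟧ ≡ ⟦ n ⟧ ^ℚ m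
⟦⟧-^ n zero    = refl
⟦⟧-^ n (suc m) = trans (⟦⟧-* n (n ^ m)) (cong (⟦ n ⟧ *_) (⟦⟧-^ n m))

0≤⟦⟧ : ∀ m → 0ℚ ≤ ⟦ m ⟧
0≤⟦⟧ m = nonNegative⁻¹ ⟦ m ⟧ {{normalize-nonNeg m 1}}

⟦⟧-mono : ∀ {m n} → m ℕ.≤ n → ⟦ m ⟧ ≤ ⟦ n ⟧
⟦⟧-mono {m} {n} m≤n = begin
  ⟦ m ⟧              ≡⟨ +-identityʳ ⟦ m ⟧ ⟨
  ⟦ m ⟧ + 0ℚ         ≤⟨ +-monoʳ-≤ ⟦ m ⟧ (0≤⟦⟧ (n ∸ m)) ⟩
  ⟦ m ⟧ + ⟦ n ∸ m ⟧  ≡⟨ ⟦⟧-+ m (n ∸ m) ⟨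
  ⟦ m ℕ.+ (n ∸ m) ⟧  ≡⟨ cong ⟦_⟧ (ℕₚ.m+[n∸m]≡n m≤n) ⟩
  ⟦ n ⟧              ∎
  where open ≤-Reasoning

*-monoˡ-≤-nonNeg′ : ∀ {r p q} → 0ℚ ≤ r → p ≤ q → r * p ≤ r * q
*-monoˡ-≤-nonNeg′ {r} 0≤r = *-monoˡ-≤-nonNeg r {{nonNegative 0≤r}}

*-monoʳ-≤-nonNeg′ : ∀ {r p q} → 0ℚ ≤ r → p ≤ q → p * r ≤ q * r
*-monoʳ-≤-nonNeg′ {r} 0≤r = *-monoʳ-≤-nonNeg r {{nonNegative 0≤r}}

*-nonNeg : ∀ {p q} → 0ℚ ≤ p → 0ℚ ≤ q → 0ℚ ≤ p * q
*-nonNeg {p} 0≤p 0≤q = ≤-trans (≤-reflexive (sym (*-zeroʳ p))) (*-monoˡ-≤-nonNeg′ 0≤p 0≤q)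

p≤q⇒0≤q-p : ∀ {p q} → p ≤ q → 0ℚ ≤ q - p
p≤q⇒0≤q-p {p} p≤q = ≤-trans (≤-reflexive (sym (+-inverseʳ p))) (+-monoˡ-≤ (- p) p≤q)

p-q≤p : ∀ p {q} → 0ℚ ≤ q → p - q ≤ p
p-q≤p p 0≤q = ≤-trans (+-monoʳ-≤ p (neg-antimono-≤ 0≤q)) (≤-reflexive (+-identityʳ p))

0≤½ : 0ℚ ≤ ½
0≤½ = *≤* (ℤ.+≤+ z≤n)

d*½≤d : ∀ {d} → 0ℚ ≤ d → d * ½ ≤ d
d*½≤d {d} 0≤d = ≤-trans (*-monoˡ-≤-nonNeg′ 0≤d (*≤* (ℤ.+≤+ (s≤s z≤n)))) (≤-reflexive (*-identityʳ d))

d*½+d*½≡d : ∀ d → d * ½ + d * ½ ≡ d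
d*½+d*½≡d = solve 1 (λ d → d :* con ½ :+ d :* con ½ := d) refl

m≤g+b⇒[1-β]m≤g : ∀ {m g b β} → m ℕ.≤ g ℕ.+ b → ⟦ b ⟧ ≤ β * ⟦ m ⟧ → (1ℚ - β) * ⟦ m ⟧ ≤ ⟦ g ⟧
m≤g+b⇒[1-β]m≤g {m} {g} {b} {β} m≤g+b b≤βm = begin
  (1ℚ - β) * ⟦ m ⟧               ≡⟨ solve 2 (λ β m → (con 1ℚ :- β) :* m := m :- β :* m) refl β ⟦ m ⟧ ⟩
  ⟦ m ⟧ - β * ⟦ m ⟧              ≤⟨ +-monoˡ-≤ (- (β * ⟦ m ⟧)) (⟦⟧-mono m≤g+b) ⟩
  ⟦ g ℕ.+ b ⟧ - β * ⟦ m ⟧        ≡⟨ cong (_- β * ⟦ m ⟧) (⟦⟧-+ g b) ⟩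
  ⟦ g ⟧ + ⟦ b ⟧ - β * ⟦ m ⟧      ≤⟨ +-monoˡ-≤ (- (β * ⟦ m ⟧)) (+-monoʳ-≤ ⟦ g ⟧ b≤βm) ⟩
  ⟦ g ⟧ + β * ⟦ m ⟧ - β * ⟦ m ⟧  ≡⟨ solve 2 (λ g c → g :+ c :- c := g) refl ⟦ g ⟧ (β * ⟦ m ⟧) ⟩
  ⟦ g ⟧                          ∎
  where open ≤-Reasoning

^ℚ-nonNeg : ∀ {p} m → 0ℚ ≤ p → 0ℚ ≤ p ^ℚ m
^ℚ-nonNeg zero    _   = 0≤⟦⟧ 1
^ℚ-nonNeg (suc m) 0≤p = *-nonNeg 0≤p (^ℚ-nonNeg m 0≤p)

^ℚ-≤1 : ∀ {p} m → 0ℚ ≤ p → p ≤ 1ℚ → p ^ℚ m ≤ 1ℚ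
^ℚ-≤1     zero    _   _   = ≤-refl
^ℚ-≤1 {p} (suc m) 0≤p p≤1 = begin
  p * p ^ℚ m  ≤⟨ *-monoˡ-≤-nonNeg′ 0≤p (^ℚ-≤1 m 0≤p p≤1) ⟩
  p * 1ℚ      ≡⟨ *-identityʳ p ⟩
  p           ≤⟨ p≤1 ⟩
  1ℚ          ∎
  where open ≤-Reasoning

^ℚ-antitone : ∀ {p m m′} → 0ℚ ≤ p → p ≤ 1ℚ → m ℕ.≤ m′ → p ^ℚ m′ ≤ p ^ℚ m
^ℚ-antitone {m′ = m′} 0≤p p≤1 z≤n        = ^ℚ-≤1 m′ 0≤p p≤1
^ℚ-antitone           0≤p p≤1 (s≤s m≤m′) = *-monoˡ-≤-nonNeg′ 0≤p (^ℚ-antitone 0≤p p≤1 m≤m′)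

^ℚ-distribʳ-* : ∀ p q m → (p * q) ^ℚ m ≡ p ^ℚ m * q ^ℚ m
^ℚ-distribʳ-* p q zero    = refl
^ℚ-distribʳ-* p q (suc m) = trans (cong ((p * q) *_) (^ℚ-distribʳ-* p q m))
  (solve 4 (λ p q a b → (p :* q) :* (a :* b) := (p :* a) :* (q :* b)) refl p q (p ^ℚ m) (q ^ℚ m))

bernoulli : ∀ {x} m → 0ℚ ≤ x → x ≤ 1ℚ → 1ℚ - ⟦ m ⟧ * x ≤ (1ℚ - x) ^ℚ m
bernoulli {x} zero    _   _   = ≤-reflexive (cong (λ c → 1ℚ - c) (*-zeroˡ x))
bernoulli {x} (suc m) 0≤x x≤1 = begin
  1ℚ - ⟦ 1 ℕ.+ m ⟧ * x                 ≡⟨ cong (λ c → 1ℚ - c * x) (⟦⟧-+ 1 m) ⟩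
  1ℚ - (1ℚ + M) * x                    ≡⟨ expand ⟩
  (1ℚ - x) * (1ℚ - M * x) - M * x * x  ≤⟨ p-q≤p _ (*-nonNeg (*-nonNeg (0≤⟦⟧ m) 0≤x) 0≤x) ⟩
  (1ℚ - x) * (1ℚ - M * x)              ≤⟨ *-monoˡ-≤-nonNeg′ (p≤q⇒0≤q-p x≤1) (bernoulli m 0≤x x≤1) ⟩
  (1ℚ - x) * (1ℚ - x) ^ℚ m             ∎
  where
  open ≤-Reasoning
  M = ⟦ m ⟧
  expand : 1ℚ - (1ℚ + M) * x ≡ (1ℚ - x) * (1ℚ - M * x) - M * x * x
  expand = solve 2 (λ M x → con 1ℚ :- (con 1ℚ :+ M) :* x
                          := (con 1ℚ :- x) :* (con 1ℚ :- M :* x) :- M :* x :* x) refl M x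

bernoulli-power : ∀ {β} n m → 0ℚ ≤ β → β ≤ 1ℚ →
  (1ℚ - ⟦ m ⟧ * β) * ⟦ n ^ m ⟧ ≤ ((1ℚ - β) * ⟦ n ⟧) ^ℚ m
bernoulli-power {β} n m 0≤β β≤1 = begin
  (1ℚ - ⟦ m ⟧ * β) * ⟦ n ^ m ⟧   ≡⟨ cong ((1ℚ - ⟦ m ⟧ * β) *_) (⟦⟧-^ n m) ⟩
  (1ℚ - ⟦ m ⟧ * β) * ⟦ n ⟧ ^ℚ m  ≤⟨ *-monoʳ-≤-nonNeg′ (^ℚ-nonNeg m (0≤⟦⟧ n)) (bernoulli m 0≤β β≤1) ⟩
  (1ℚ - β) ^ℚ m * ⟦ n ⟧ ^ℚ m     ≡⟨ ^ℚ-distribʳ-* (1ℚ - β) ⟦ n ⟧ m ⟨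
  ((1ℚ - β) * ⟦ n ⟧) ^ℚ m        ∎
  where open ≤-Reasoning

sumF-≥-scaled : ∀ {n} q (f g : Fin n → ℕ) → (∀ i → q * ⟦ g i ⟧ ≤ ⟦ f i ⟧) →
  q * ⟦ sumF g ⟧ ≤ ⟦ sumF f ⟧
sumF-≥-scaled {zero}  q f g _    = ≤-reflexive (*-zeroʳ q)
sumF-≥-scaled {suc n} q f g qg≤f = begin
  q * ⟦ g zero ℕ.+ sumF (g ∘ suc) ⟧        ≡⟨ cong (q *_) (⟦⟧-+ (g zero) _) ⟩
  q * (⟦ g zero ⟧ + ⟦ sumF (g ∘ suc) ⟧)    ≡⟨ *-distribˡ-+ q _ _ ⟩
  q * ⟦ g zero ⟧ + q * ⟦ sumF (g ∘ suc) ⟧  ≤⟨ +-mono-≤ (qg≤f zero)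
                                                (sumF-≥-scaled q (f ∘ suc) (g ∘ suc) (qg≤f ∘ suc)) ⟩
  ⟦ f zero ⟧ + ⟦ sumF (f ∘ suc) ⟧          ≡⟨ ⟦⟧-+ (f zero) _ ⟨
  ⟦ f zero ℕ.+ sumF (f ∘ suc) ⟧            ∎
  where open ≤-Reasoning

sumF-≤-scaled : ∀ {n} q (f g : Fin n → ℕ) → (∀ i → ⟦ f i ⟧ ≤ q * ⟦ g i ⟧) →
  ⟦ sumF f ⟧ ≤ q * ⟦ sumF g ⟧
sumF-≤-scaled {zero}  q f g _    = ≤-reflexive (sym (*-zeroʳ q))
sumF-≤-scaled {suc n} q f g f≤qg = begin
  ⟦ f zero ℕ.+ sumF (f ∘ suc) ⟧            ≡⟨ ⟦⟧-+ (f zero) _ ⟩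
  ⟦ f zero ⟧ + ⟦ sumF (f ∘ suc) ⟧          ≤⟨ +-mono-≤ (f≤qg zero)
                                                (sumF-≤-scaled q (f ∘ suc) (g ∘ suc) (f≤qg ∘ suc)) ⟩
  q * ⟦ g zero ⟧ + q * ⟦ sumF (g ∘ suc) ⟧  ≡⟨ *-distribˡ-+ q _ _ ⟨
  q * (⟦ g zero ⟧ + ⟦ sumF (g ∘ suc) ⟧)    ≡⟨ cong (q *_) (⟦⟧-+ (g zero) _) ⟨
  q * ⟦ g zero ℕ.+ sumF (g ∘ suc) ⟧        ∎
  where open ≤-Reasoning

-- Greedy counting of tuples

module _ {n : ℕ} (Inv : ∀ {m} → ((Fin m → Fin n) → Bool) → Set) {G : ℚ} (0≤G : 0ℚ ≤ G)
  (done : ∀ {P} → Inv {0} P → ∀ t → P t ≡ true)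
  (extend : ∀ {m P} → Inv {suc m} P →
    Σ[ A ∈ (Fin n → Bool) ] (G ≤ ⟦ ∣ A ∣ ⟧ × (∀ a → A a ≡ true → Inv (λ t → P (a ∷ t)))))
  where

  countTuples-greedy : ∀ {m P} → Inv {m} P → G ^ℚ m ≤ ⟦ countTuples P ⟧
  countTuples-greedy {zero}  {P} inv = ≤-reflexive (cong (⟦_⟧ ∘ 𝟙) (sym (done inv _)))
  countTuples-greedy {suc m} {P} inv with extend inv
  ... | A , G≤∣A∣ , A⇒inv = begin
    G * G ^ℚ m          ≤⟨ *-monoʳ-≤-nonNeg′ (^ℚ-nonNeg m 0≤G) G≤∣A∣ ⟩
    ⟦ ∣ A ∣ ⟧ * G ^ℚ m  ≡⟨ *-comm ⟦ ∣ A ∣ ⟧ (G ^ℚ m) ⟩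
    G ^ℚ m * ⟦ ∣ A ∣ ⟧  ≤⟨ sumF-≥-scaled (G ^ℚ m) _ (𝟙 ∘ A) branch ⟩
    ⟦ countTuples P ⟧   ∎
    where
    open ≤-Reasoning
    branch : ∀ a → G ^ℚ m * ⟦ 𝟙 (A a) ⟧ ≤ ⟦ countTuples (λ t → P (a ∷ t)) ⟧
    branch a with A a in Aa
    ... | true  = ≤-trans (≤-reflexive (*-identityʳ (G ^ℚ m))) (countTuples-greedy (A⇒inv a Aa))
    ... | false = ≤-trans (≤-reflexive (*-zeroʳ (G ^ℚ m))) (0≤⟦⟧ (countTuples (λ t → P (a ∷ t))))

-- Neighbourhoods in V₁ and regularity

_∩_ : ∀ {n} → (Fin n → Bool) → (Fin n → Bool) → Fin n → Bool
(Y ∩ Z) a = Y a ∧ Z a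

module _ {k n : ℕ} (E : Graph (suc k) n) where

  nbrs : Fin k → Fin n → Fin n → Bool
  nbrs c b a = E zero a (suc c) b

  jointNbrs : ∀ {m} → (Fin m → Fin k) → (Fin m → Fin n) → Fin n → Bool
  jointNbrs σ t a = allF (λ i → nbrs (σ i) (t i) a)

  Dense : ℚ → (Fin n → Bool) → Fin k → Fin n → Set
  Dense d Y c b = d * ⟦ ∣ Y ∣ ⟧ < ⟦ ∣ Y ∩ nbrs c b ∣ ⟧

  thin : ℚ → (Fin n → Bool) → Fin k → Fin n → Bool
  thin d Y c b = ⌊ ⟦ ∣ Y ∩ nbrs c b ∣ ⟧ ≤? d * ⟦ ∣ Y ∣ ⟧ ⌋

  thin-cong : ∀ {d Y Z} → Y ≗ Z → ∀ c b → thin d Y c b ≡ thin d Z c b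
  thin-cong {d} Y≗Z c b = cong₂ (λ p q → ⌊ ⟦ p ⟧ ≤? d * ⟦ q ⟧ ⌋)
    (card-cong λ a → cong (_∧ nbrs c b a) (Y≗Z a)) (card-cong Y≗Z)

  thin≡false⇒Dense : ∀ {d c b} Y → thin d Y c b ≡ false → Dense d Y c b
  thin≡false⇒Dense {d} {c} {b} Y thin≡false =
    ≰⇒> (⌊⌋≡false⇒¬ (⟦ ∣ Y ∩ nbrs c b ∣ ⟧ ≤? d * ⟦ ∣ Y ∣ ⟧) thin≡false)

  eXY≤ : ∀ (Y B : Fin n → Bool) c q → (∀ b → B b ≡ true → ⟦ ∣ Y ∩ nbrs c b ∣ ⟧ ≤ q) →
    ⟦ eXY E zero (suc c) Y B ⟧ ≤ q * ⟦ ∣ B ∣ ⟧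
  eXY≤ Y B c q B⇒deg≤q = begin
    ⟦ eXY E zero (suc c) Y B ⟧                  ≡⟨ cong ⟦_⟧ (sumF-swap (λ a b → edge a b)) ⟩
    ⟦ sumF (λ b → sumF (λ a → edge a b)) ⟧      ≤⟨ sumF-≤-scaled q _ (𝟙 ∘ B) column ⟩
    q * ⟦ ∣ B ∣ ⟧                                ∎
    where
    open ≤-Reasoning
    edge : Fin n → Fin n → ℕ
    edge a b = 𝟙 (Y a ∧ B b ∧ E zero a (suc c) b)
    column : ∀ b → ⟦ sumF (λ a → edge a b) ⟧ ≤ q * ⟦ 𝟙 (B b) ⟧
    column b with B b in Bb
    ... | true  = ≤-trans (B⇒deg≤q b Bb) (≤-reflexive (sym (*-identityʳ q)))
    ... | false = ≤-trans (≤-reflexive (cong ⟦_⟧ (card-empty (λ a → ∧-zeroʳ (Y a)))))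
                          (≤-reflexive (sym (*-zeroʳ q)))

  -- Otherwise Y and the thin vertices would be a pair of sizes ≥ εn and density at most d.
  ∣thin∣<εn : ∀ {ε d} c (Y : Fin n → Bool) → SuperRegular ε d E zero (suc c) →
    ε * ⟦ n ⟧ ≤ ⟦ ∣ Y ∣ ⟧ → ⟦ ∣ thin d Y c ∣ ⟧ < ε * ⟦ n ⟧
  ∣thin∣<εn {ε} {d} c Y (regular , _) εn≤Y = ≰⇒> λ εn≤B →
    <-irrefl refl (<-≤-trans (regular Y (thin d Y c) εn≤Y εn≤B)
      (eXY≤ Y (thin d Y c) c (d * ⟦ ∣ Y ∣ ⟧) (λ b → ⌊⌋≡true⇒ (⟦ ∣ Y ∩ nbrs c b ∣ ⟧ ≤? d * ⟦ ∣ Y ∣ ⟧))))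

  isEdgeF-cong : ∀ d X → Congruent _≗_ _≡_ (isEdgeF d E X)
  isEdgeF-cong d X {t} {u} t≗u =
    cong₂ (λ p q → ⌊ (d * ½) ^ℚ k * ⟦ n ⟧ ≤? ⟦ p ⟧ ⌋ ∧ ⌊ (d * ½) ^ℚ k * ⟦ ∣ X ∣ ⟧ ≤? ⟦ q ⟧ ⌋)
      (commonNbrs-cong V₁) (commonNbrs-cong X)
    where
    commonNbrs-cong : ∀ Z → commonNbrs E Z t ≡ commonNbrs E Z u
    commonNbrs-cong Z = card-cong λ a →
      cong (Z a ∧_) (allF-cong λ j → cong (E zero a (suc j)) (t≗u j))

-- With n = 0 the density condition fails for the empty pair.
superRegular⇒d<1 : ∀ {r n ε d} {E : Graph r n} {i j} → SuperRegular ε d E i j → d < 1ℚ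
superRegular⇒d<1 {n = zero} {ε} {d} (regular , _) =
  ⊥-elim (<-irrefl (*-zeroʳ (d * 0ℚ)) (regular (λ ()) (λ ()) ε0≤0 ε0≤0))
  where ε0≤0 = ≤-reflexive (*-zeroʳ ε)
superRegular⇒d<1 {n = suc n} {d = d} {E} {i} {j} (_ , degree , _) =
  *-cancelʳ-<-nonNeg ⟦ suc n ⟧ {{normalize-nonNeg (suc n) 1}} (begin-strict
    d * ⟦ suc n ⟧                  <⟨ degree zero ⟩
    ⟦ ∣ (λ b → E i zero j b) ∣ ⟧    ≤⟨ ⟦⟧-mono (card≤n (λ b → E i zero j b)) ⟩
    ⟦ suc n ⟧                      ≡⟨ *-identityˡ ⟦ suc n ⟧ ⟨
    1ℚ * ⟦ suc n ⟧                 ∎)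
  where open ≤-Reasoning

-- The greedy degree bound

module _ {K n : ℕ} (d : ℚ) (E : Graph (suc (suc K)) n) (X : Fin n → Bool) where

  private
    ρ : ℚ
    ρ = d * ½

  record Large (s : ℕ) (Y : Fin n → Bool) : Set where
    constructor large
    field
      inV₁ : ρ ^ℚ s * ⟦ n ⟧ ≤ ⟦ ∣ Y ∣ ⟧
      inX  : ρ ^ℚ s * ⟦ ∣ X ∣ ⟧ ≤ ⟦ ∣ X ∩ Y ∣ ⟧

  Large-cong : ∀ {s Y Z} → Y ≗ Z → Large s Y → Large s Z
  Large-cong {s} Y≗Z (large Yₙ Yₓ) = large
    (subst (λ y → ρ ^ℚ s * ⟦ n ⟧ ≤ ⟦ y ⟧) (card-cong Y≗Z) Yₙ)
    (subst (λ y → ρ ^ℚ s * ⟦ ∣ X ∣ ⟧ ≤ ⟦ y ⟧) (card-cong (cong (X _ ∧_) ∘ Y≗Z)) Yₓ)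

  large⇒isEdgeF : ∀ u → Large (suc K) (jointNbrs E (λ c → c) u) → isEdgeF d E X u ≡ true
  large⇒isEdgeF u (large Lₙ Lₓ) = cong₂ _∧_
    (⌊⌋≡true (ρ ^ℚ suc K * ⟦ n ⟧ ≤? ⟦ commonNbrs E V₁ u ⟧) Lₙ)
    (⌊⌋≡true (ρ ^ℚ suc K * ⟦ ∣ X ∣ ⟧ ≤? ⟦ commonNbrs E X u ⟧) Lₓ)

  jointNbrs-insertAt : ∀ (t : Fin K → Fin n) j v →
    nbrs E j v ∩ jointNbrs E (punchIn j) t ≗ jointNbrs E (λ c → c) (insertAt t j v)
  jointNbrs-insertAt t j v a = sym (trans (allF-punchIn (λ c → nbrs E c (insertAt t j v c) a) j)
    (cong₂ _∧_ (cong (λ w → nbrs E j w a) (insertAt-lookup t j v))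
               (allF-cong λ i → cong (λ w → nbrs E (punchIn j i) w a) (insertAt-punchIn t j v i))))

  good : (Fin n → Bool) → Fin (suc K) → Fin n → Bool
  good Y c b = not (thin E d Y c b) ∧ not (thin E d (X ∩ Y) c b)

  good⇒Dense : ∀ {Y c b} → good Y c b ≡ true → Dense E d Y c b × Dense E d (X ∩ Y) c b
  good⇒Dense {Y} {c} {b} g =
    thin≡false⇒Dense E {d} {c} {b} Y (proj₁ (not∧not≡true⇒ g)) ,
    thin≡false⇒Dense E {d} {c} {b} (X ∩ Y) (proj₂ (not∧not≡true⇒ g))

  ManyGood : ℚ → Set
  ManyGood β = ∀ Y c → Large K Y → (1ℚ - β) * ⟦ n ⟧ ≤ ⟦ ∣ good Y c ∣ ⟧

  -- P is the edge predicate of F_X restricted to the tuples extending the `stage` vertices chosen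
  -- so far; `common` is their common neighbourhood in V₁ and `classes` are the classes of the
  -- remaining coordinates.
  record Reachable {m} (P : (Fin m → Fin n) → Bool) : Set where
    field
      stage   : ℕ
      stage+m : stage ℕ.+ m ≡ suc K
      classes : Fin m → Fin (suc K)
      common  : Fin n → Bool
      isLarge : Large stage common
      sound   : ∀ t → Large (suc K) (common ∩ jointNbrs E classes t) → P t ≡ true

  module _ (0≤d : 0ℚ ≤ d) (d≤1 : d ≤ 1ℚ) where

    private
      0≤ρ : 0ℚ ≤ ρ
      0≤ρ = *-nonNeg 0≤d 0≤½

      ρ≤1 : ρ ≤ 1ℚ
      ρ≤1 = ≤-trans (d*½≤d 0≤d) d≤1

    ρ-power-step : ∀ {s z y y′} → ρ ^ℚ s * z ≤ ⟦ y ⟧ → d * ⟦ y ⟧ < ⟦ y′ ⟧ → ρ ^ℚ suc s * z ≤ ⟦ y′ ⟧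
    ρ-power-step {s} {z} {y} {y′} ρˢz≤y dy<y′ = begin
      ρ * ρ ^ℚ s * z    ≡⟨ *-assoc ρ (ρ ^ℚ s) z ⟩
      ρ * (ρ ^ℚ s * z)  ≤⟨ *-monoˡ-≤-nonNeg′ 0≤ρ ρˢz≤y ⟩
      ρ * ⟦ y ⟧         ≤⟨ *-monoʳ-≤-nonNeg′ (0≤⟦⟧ y) (d*½≤d 0≤d) ⟩
      d * ⟦ y ⟧         ≤⟨ <⇒≤ dy<y′ ⟩
      ⟦ y′ ⟧            ∎
      where open ≤-Reasoning

    Large-extend : ∀ {s Y c b} → Large s Y → Dense E d Y c b → Dense E d (X ∩ Y) c b →
      Large (suc s) (Y ∩ nbrs E c b)
    Large-extend {s} {Y} {c} {b} (large Yₙ Yₓ) denseY denseXY = large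
      (ρ-power-step {s} {y = ∣ Y ∣} {∣ Y ∩ nbrs E c b ∣} Yₙ denseY)
      (ρ-power-step {s} {y = ∣ X ∩ Y ∣} {∣ X ∩ (Y ∩ nbrs E c b) ∣} Yₓ
        (subst (λ y → d * ⟦ ∣ X ∩ Y ∣ ⟧ < ⟦ y ⟧) (card-cong λ a → ∧-assoc (X a) (Y a) _) denseXY))

    Large-weaken : ∀ {s s′ Y} → s ℕ.≤ s′ → Large s Y → Large s′ Y
    Large-weaken {s} {s′} s≤s′ (large Yₙ Yₓ) = large
      (≤-trans (*-monoʳ-≤-nonNeg′ (0≤⟦⟧ n) ρˢ′≤ρˢ) Yₙ)
      (≤-trans (*-monoʳ-≤-nonNeg′ (0≤⟦⟧ ∣ X ∣) ρˢ′≤ρˢ) Yₓ)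
      where
      ρˢ′≤ρˢ : ρ ^ℚ s′ ≤ ρ ^ℚ s
      ρˢ′≤ρˢ = ^ℚ-antitone 0≤ρ ρ≤1 s≤s′

    reachable-start : ∀ j v → d * ⟦ n ⟧ < ⟦ ∣ nbrs E j v ∣ ⟧ → Dense E d X j v →
      Reachable (λ t → isEdgeF d E X (insertAt t j v))
    reachable-start j v deg denseX = record
      { stage   = 1
      ; stage+m = refl
      ; classes = punchIn j
      ; common  = nbrs E j v
      ; isLarge = large
          (ρ-power-step {0} {y = n} {∣ nbrs E j v ∣} (≤-reflexive (*-identityˡ ⟦ n ⟧)) deg)
          (ρ-power-step {0} {y = ∣ X ∣} {∣ X ∩ nbrs E j v ∣} (≤-reflexive (*-identityˡ ⟦ ∣ X ∣ ⟧)) denseX)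
      ; sound   = λ t L → large⇒isEdgeF (insertAt t j v) (Large-cong (jointNbrs-insertAt t j v) L)
      }

    reachable-done : ∀ {P} → Reachable {0} P → ∀ t → P t ≡ true
    reachable-done r t = sound t (Large-cong (λ a → sym (∧-identityʳ (common a)))
      (subst (λ s → Large s common) (trans (sym (ℕₚ.+-identityʳ stage)) stage+m) isLarge))
      where open Reachable r

    reachable-extend : ∀ {β} → ManyGood β → ∀ {m P} → Reachable {suc m} P →
      Σ[ A ∈ (Fin n → Bool) ]
        ((1ℚ - β) * ⟦ n ⟧ ≤ ⟦ ∣ A ∣ ⟧ × (∀ a → A a ≡ true → Reachable (λ t → P (a ∷ t))))
    reachable-extend manyGood {m} {P} r =
      good common (classes zero) , manyGood common (classes zero) (Large-weaken stage≤K isLarge) , next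
      where
      open Reachable r
      stage+m′ : suc (stage ℕ.+ m) ≡ suc K
      stage+m′ = trans (sym (ℕₚ.+-suc stage m)) stage+m
      stage≤K : stage ℕ.≤ K
      stage≤K = subst (stage ℕ.≤_) (ℕₚ.suc-injective stage+m′) (ℕₚ.m≤m+n stage m)
      next : ∀ a → good common (classes zero) a ≡ true → Reachable (λ t → P (a ∷ t))
      next a g = record
        { stage   = suc stage
        ; stage+m = stage+m′
        ; classes = classes ∘ suc
        ; common  = common ∩ nbrs E (classes zero) a
        ; isLarge = Large-extend isLarge (proj₁ (good⇒Dense g)) (proj₂ (good⇒Dense g))
        ; sound   = λ t L → sound (a ∷ t) (Large-cong (λ b →
            ∧-assoc (common b) (nbrs E (classes zero) a b) (jointNbrs E (classes ∘ suc) t b)) L)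
        }

    degF-bound : ∀ {β} → 0ℚ ≤ β → β ≤ 1ℚ → ManyGood β → ∀ j v →
      d * ⟦ n ⟧ < ⟦ ∣ nbrs E j v ∣ ⟧ → Dense E d X j v →
      (1ℚ - ⟦ K ⟧ * β) * ⟦ n ^ K ⟧ ≤ ⟦ degF d E X j v ⟧
    degF-bound {β} 0≤β β≤1 manyGood j v deg denseX = begin
      (1ℚ - ⟦ K ⟧ * β) * ⟦ n ^ K ⟧                            ≤⟨ bernoulli-power n K 0≤β β≤1 ⟩
      ((1ℚ - β) * ⟦ n ⟧) ^ℚ K                                 ≤⟨ greedy ⟩
      ⟦ countTuples (λ t → isEdgeF d E X (insertAt t j v)) ⟧  ≤⟨ ⟦⟧-mono fix-v ⟩
      ⟦ degF d E X j v ⟧                                      ∎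
      where
      open ≤-Reasoning
      greedy : ((1ℚ - β) * ⟦ n ⟧) ^ℚ K ≤ ⟦ countTuples (λ t → isEdgeF d E X (insertAt t j v)) ⟧
      greedy = countTuples-greedy Reachable (*-nonNeg (p≤q⇒0≤q-p β≤1) (0≤⟦⟧ n))
        reachable-done (reachable-extend {β} manyGood) (reachable-start j v deg denseX)
      fix-v : countTuples (λ t → isEdgeF d E X (insertAt t j v)) ℕ.≤ degF d E X j v
      fix-v = countTuples-insertAt (isEdgeF d E X) (isEdgeF-cong E d X) j v

-- Super-regularity supplies the good candidates

module _ {K n ε d} (E : Graph (suc (suc K)) n) (1≤K : 1 ℕ.≤ K)
  (regular : ∀ j → SuperRegular ε d E zero (suc j)) (0<ε : 0ℚ < ε) (0<d : 0ℚ < d)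
  (ε≤ρᴷ : ε ≤ (d * ½) ^ℚ K) where

  private
    0≤d : 0ℚ ≤ d
    0≤d = <⇒≤ 0<d

    d≤1 : d ≤ 1ℚ
    d≤1 = <⇒≤ (superRegular⇒d<1 {ε = ε} {d} {E} {zero} {suc zero} (regular zero))

    0≤ρ : 0ℚ ≤ d * ½
    0≤ρ = *-nonNeg 0≤d 0≤½

    ρ≤1 : d * ½ ≤ 1ℚ
    ρ≤1 = ≤-trans (d*½≤d 0≤d) d≤1

    ε≤ρ : ε ≤ d * ½
    ε≤ρ = ≤-trans ε≤ρᴷ (≤-trans (^ℚ-antitone 0≤ρ ρ≤1 1≤K) (≤-reflexive (*-identityʳ (d * ½))))

    εn≤ρᴷn : ε * ⟦ n ⟧ ≤ (d * ½) ^ℚ K * ⟦ n ⟧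
    εn≤ρᴷn = *-monoʳ-≤-nonNeg′ (0≤⟦⟧ n) ε≤ρᴷ

    degree : ∀ j v → d * ⟦ n ⟧ < ⟦ ∣ nbrs E j v ∣ ⟧
    degree j v = proj₂ (proj₂ (regular j)) v

    ∣thin∣≤εn : ∀ c Y → ε * ⟦ n ⟧ ≤ ⟦ ∣ Y ∣ ⟧ → ⟦ ∣ thin E d Y c ∣ ⟧ ≤ ε * ⟦ n ⟧
    ∣thin∣≤εn c Y εn≤Y = <⇒≤ (∣thin∣<εn E {ε} {d} c Y (regular c) εn≤Y)

  manyGood-V₁ : ManyGood d E V₁ ε
  manyGood-V₁ Y c (large ρᴷn≤Y _) =
    m≤g+b⇒[1-β]m≤g {n} {∣ good d E V₁ Y c ∣} {∣ B ∣} {ε} covered (∣thin∣≤εn c Y (≤-trans εn≤ρᴷn ρᴷn≤Y))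
    where
    B = thin E d Y c
    cover : ∀ b → 1 ℕ.≤ 𝟙 (not (B b) ∧ not (thin E d (V₁ ∩ Y) c b)) ℕ.+ 𝟙 (B b)
    cover b = subst (λ y → 1 ℕ.≤ 𝟙 (not (B b) ∧ not y) ℕ.+ 𝟙 (B b))
                    (sym (thin-cong E {d} {V₁ ∩ Y} {Y} (λ _ → refl) c b)) (cover-twice (B b))
      where
      cover-twice : ∀ x → 1 ℕ.≤ 𝟙 (not x ∧ not x) ℕ.+ 𝟙 x
      cover-twice true  = s≤s z≤n
      cover-twice false = s≤s z≤n
    covered : n ℕ.≤ ∣ good d E V₁ Y c ∣ ℕ.+ ∣ B ∣
    covered = ℕₚ.≤-trans (n≤sumF (λ b → 𝟙 (good d E V₁ Y c b) ℕ.+ 𝟙 (B b)) cover)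
                         (ℕₚ.≤-reflexive (sumF-+ (𝟙 ∘ good d E V₁ Y c) (𝟙 ∘ B)))

  manyGood-X : ∀ X → ε * ⟦ n ⟧ ≤ (d * ½) ^ℚ K * ⟦ ∣ X ∣ ⟧ → ManyGood d E X (ε + ε)
  manyGood-X X εn≤ρᴷX Y c (large ρᴷn≤Y ρᴷX≤XY) =
    m≤g+b⇒[1-β]m≤g {n} {∣ good d E X Y c ∣} {∣ B₁ ∣ ℕ.+ ∣ B₂ ∣} {ε + ε} covered (begin
      ⟦ ∣ B₁ ∣ ℕ.+ ∣ B₂ ∣ ⟧    ≡⟨ ⟦⟧-+ ∣ B₁ ∣ ∣ B₂ ∣ ⟩
      ⟦ ∣ B₁ ∣ ⟧ + ⟦ ∣ B₂ ∣ ⟧  ≤⟨ +-mono-≤ (∣thin∣≤εn c Y (≤-trans εn≤ρᴷn ρᴷn≤Y))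
                                          (∣thin∣≤εn c (X ∩ Y) (≤-trans εn≤ρᴷX ρᴷX≤XY)) ⟩
      ε * ⟦ n ⟧ + ε * ⟦ n ⟧  ≡⟨ *-distribʳ-+ ⟦ n ⟧ ε ε ⟨
      (ε + ε) * ⟦ n ⟧        ∎)
    where
    open ≤-Reasoning
    B₁ = thin E d Y c
    B₂ = thin E d (X ∩ Y) c
    cover : ∀ x y → 1 ℕ.≤ 𝟙 (not x ∧ not y) ℕ.+ (𝟙 x ℕ.+ 𝟙 y)
    cover true  _     = s≤s z≤n
    cover false true  = s≤s z≤n
    cover false false = s≤s z≤n
    covered : n ℕ.≤ ∣ good d E X Y c ∣ ℕ.+ (∣ B₁ ∣ ℕ.+ ∣ B₂ ∣)
    covered = ℕₚ.≤-trans
      (n≤sumF (λ b → 𝟙 (good d E X Y c b) ℕ.+ (𝟙 (B₁ b) ℕ.+ 𝟙 (B₂ b))) (λ b → cover (B₁ b) (B₂ b)))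
      (ℕₚ.≤-reflexive (trans (sumF-+ (𝟙 ∘ good d E X Y c) (λ b → 𝟙 (B₁ b) ℕ.+ 𝟙 (B₂ b)))
                             (cong (∣ good d E X Y c ∣ ℕ.+_) (sumF-+ (𝟙 ∘ B₁) (𝟙 ∘ B₂)))))

  degF-V₁-bound : ∀ j v → (1ℚ - ⟦ K ⟧ * ε) * ⟦ n ^ K ⟧ ≤ ⟦ degF d E V₁ j v ⟧
  degF-V₁-bound j v = degF-bound d E V₁ 0≤d d≤1 {ε} (<⇒≤ 0<ε) (≤-trans ε≤ρ ρ≤1) manyGood-V₁ j v
    (degree j v) (subst (λ m → d * ⟦ m ⟧ < ⟦ ∣ nbrs E j v ∣ ⟧) (sym (card-V₁ {n})) (degree j v))

  ∣thin-X∣≤εn : ∀ X → ε * ⟦ n ⟧ ≤ (d * ½) ^ℚ K * ⟦ ∣ X ∣ ⟧ → ∀ j → ⟦ ∣ thin E d X j ∣ ⟧ ≤ ε * ⟦ n ⟧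
  ∣thin-X∣≤εn X εn≤ρᴷX j = ∣thin∣≤εn j X (≤-trans εn≤ρᴷX ρᴷX≤X)
    where
    ρᴷX≤X : (d * ½) ^ℚ K * ⟦ ∣ X ∣ ⟧ ≤ ⟦ ∣ X ∣ ⟧
    ρᴷX≤X = ≤-trans (*-monoʳ-≤-nonNeg′ (0≤⟦⟧ ∣ X ∣) (^ℚ-≤1 K 0≤ρ ρ≤1)) (≤-reflexive (*-identityˡ ⟦ ∣ X ∣ ⟧))

  degF-X-bound : ∀ X → ε * ⟦ n ⟧ ≤ (d * ½) ^ℚ K * ⟦ ∣ X ∣ ⟧ → ∀ j v → thin E d X j v ≡ false →
    (1ℚ - ⟦ 2 ℕ.* K ⟧ * ε) * ⟦ n ^ K ⟧ ≤ ⟦ degF d E X j v ⟧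
  degF-X-bound X εn≤ρᴷX j v thin≡false =
    subst (λ c → (1ℚ - c) * ⟦ n ^ K ⟧ ≤ ⟦ degF d E X j v ⟧) (sym 2K·ε≡K·2ε)
      (degF-bound d E X 0≤d d≤1 {ε + ε} (+-mono-≤ 0≤ε 0≤ε) 2ε≤1 (manyGood-X X εn≤ρᴷX) j v
        (degree j v) (thin≡false⇒Dense E {d} {j} {v} X thin≡false))
    where
    0≤ε = <⇒≤ 0<ε
    2ε≤1 : ε + ε ≤ 1ℚ
    2ε≤1 = ≤-trans (+-mono-≤ ε≤ρ ε≤ρ) (≤-trans (≤-reflexive (d*½+d*½≡d d)) d≤1)
    2K·ε≡K·2ε : ⟦ 2 ℕ.* K ⟧ * ε ≡ ⟦ K ⟧ * (ε + ε)
    2K·ε≡K·2ε = trans (cong (_* ε) (⟦⟧-* 2 K))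
      (solve 2 (λ k e → con ⟦ 2 ⟧ :* k :* e := k :* (e :+ e)) refl ⟦ K ⟧ ε)

lemma4p7 : (k : ℕ) → 3 ℕ.≤ suc k → (ε d : ℚ) → 0ℚ < ε → 0ℚ < d →
  ε ≤ (d * ½) ^ℚ (k ∸ 1) →
  (n : ℕ) (E : Graph (suc k) n) → IsRPartiteGraph E →
  ((j : Fin k) → SuperRegular ε d E zero (suc j)) →
  ((j : Fin k) (v : Fin n) →
     (1ℚ - ⟦ k ∸ 1 ⟧ * ε) * ⟦ n ^ (k ∸ 1) ⟧ ≤ ⟦ degF d E V₁ j v ⟧) ×
  ((X : Fin n → Bool) → ε * ⟦ n ⟧ ≤ ((d * ½) ^ℚ (k ∸ 1)) * ⟦ ∣ X ∣ ⟧ →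
     (j : Fin k) → Σ[ B ∈ (Fin n → Bool) ] (⟦ ∣ B ∣ ⟧ ≤ ε * ⟦ n ⟧ ×
       ((v : Fin n) → B v ≡ false →
         (1ℚ - ⟦ 2 ℕ.* (k ∸ 1) ⟧ * ε) * ⟦ n ^ (k ∸ 1) ⟧ ≤ ⟦ degF d E X j v ⟧)))
lemma4p7 zero          (s≤s ())
lemma4p7 (suc zero)    (s≤s (s≤s ()))
lemma4p7 (suc (suc _)) _ ε d 0<ε 0<d ε≤ρᴷ n E _ regular =
    degF-V₁-bound E 1≤K regular 0<ε 0<d ε≤ρᴷ
  , λ X εn≤ρᴷX j → thin E d X j
                 , ∣thin-X∣≤εn E 1≤K regular 0<ε 0<d ε≤ρᴷ X εn≤ρᴷX j
                 , degF-X-bound E 1≤K regular 0<ε 0<d ε≤ρᴷ X εn≤ρᴷX j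
  where
  1≤K = s≤s z≤n
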